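{- In the loop-free multigraph game, the Angel has a winning strategy for every starting position; that is, for every finite loop-free multigraph $G$ with a graphical degree sequence, the Angel has a strategy such that, whatever the Devil's choices, she is always able to move and a simple graph is reached after finitely many moves.
   Context: A loop-free multigraph is a finite undirected graph without loops in which several edges may join the same pair of distinct vertices. The type of an edge joining $u$ and $v$ is the unordered pair $\{u,v\}$, and its multiplicity is the number of edges of that type. An edge is simple if its type has multiplicity one, and a multiple edge if its type has multiplicity at least two; a graph is simple if all its edges are simple. The degree sequence is the weakly decreasing list of vertex degrees, and it is graphical if it is the degree sequence of some simple graph. Two edges are incident if they share at least one vertex. Given two distinct edges of types $\{v_1,v_2\}$ and $\{v_3,v_4\}$, the double edge swap $(v_1,v_2)(v_3,v_4)$ removes them and adds edges of types $\{v_2,v_3\}$ and $\{v_4,v_1\}$; a double edge swap on two edges $e,e'$ means any such swap with $e,e'$ as the removed edges. The loop-free multigraph game is played by the Angel and the Devil: starting from a loop-free multigraph $G$ with a graphical degree sequence, in each move the Devil chooses any multiple edge $e$ of the current graph, and then the Angel chooses any edge $e'$ not incident to $e$ and performs a double edge swap on $e$ and $e'$. The Angel wins if she reaches a simple graph; the Devil wins if the game goes on forever or if the Angel cannot make a move. -}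

module Defs where

open import Data.Nat using (ℕ; _+_)
open import Data.Bool using (Bool; true; false; if_then_else_)
open import Data.Fin using (Fin; _≟_)
open import Data.Fin.Properties using ()
open import Data.Product using (Σ; _×_; _,_; proj₁; proj₂; ∃)
open import Data.Sum using (_⊎_)
open import Data.List using (List; _∷_; []; length; map; filter; lookup; allFin)
open import Data.Nat.ListAction using (sum)
open import Data.List.Relation.Unary.All using (All)
open import Data.List.Relation.Binary.Permutation.Propositional using (_↭_)
open import Relation.Binary.PropositionalEquality using (_≡_; _≢_)
open import Relation.Nullary using (¬_; does)
open import Relation.Nullary.Decidable using (¬?; _×-dec_)

-- Each list entry is one edge; several entries of the same type are parallel edges.
Edge : ℕ → Set
Edge n = Fin n × Fin n

Graph : ℕ → Set
Graph n = List (Edge n)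

LoopFree : ∀ {n} → Graph n → Set
LoopFree = All (λ e → proj₁ e ≢ proj₂ e)

SameType : ∀ {n} → Edge n → Edge n → Set
SameType (u , v) (x , y) = (u ≡ x × v ≡ y) ⊎ (u ≡ y × v ≡ x)

EdgeIx : ∀ {n} → Graph n → Set
EdgeIx G = Fin (length G)

MultipleAt : ∀ {n} (G : Graph n) → EdgeIx G → Set
MultipleAt G i = Σ (EdgeIx G) λ j → (j ≢ i) × SameType (lookup G i) (lookup G j)

IsSimple : ∀ {n} → Graph n → Set
IsSimple G = ∀ (i j : EdgeIx G) → SameType (lookup G i) (lookup G j) → i ≡ j

ind : Bool → ℕ
ind b = if b then 1 else 0

deg : ∀ {n} → Graph n → Fin n → ℕ
deg G v = sum (map (λ e → ind (does (v ≟ proj₁ e)) + ind (does (v ≟ proj₂ e))) G)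

-- The list of degrees (vertex 0, 1, ..., n-1); two graphs have the same
-- degree sequence iff these lists are permutations of each other.
degList : ∀ {n} → Graph n → List ℕ
degList {n} G = map (deg G) (allFin n)

Graphical : ∀ {n} → Graph n → Set
Graphical {n} G = Σ (Graph n) λ H → LoopFree H × IsSimple H × (degList H ↭ degList G)

Incident : ∀ {n} → Edge n → Edge n → Set
Incident (a , b) (c , d) = (a ≡ c ⊎ a ≡ d) ⊎ (b ≡ c ⊎ b ≡ d)

orient : ∀ {n} → Bool → Edge n → Edge n
orient false (u , v) = (u , v)
orient true  (u , v) = (v , u)

-- A move of the Angel after the Devil chose edge i: an edge j not incident
-- to edge i, and orientations (v1,v2) of edge i and (v3,v4) of edge j.
record AngelMove {n} (G : Graph n) (i : EdgeIx G) : Set where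
  constructor move
  field
    j         : EdgeIx G
    nonIncid  : ¬ Incident (lookup G i) (lookup G j)
    flipFirst  : Bool
    flipSecond : Bool

others : ∀ {n} (G : Graph n) → EdgeIx G → EdgeIx G → Graph n
others G i j =
  map (lookup G) (filter (λ k → ¬? (k ≟ i) ×-dec ¬? (k ≟ j)) (allFin (length G)))

doubleSwap : ∀ {n} (G : Graph n) (i : EdgeIx G) → AngelMove G i → Graph n
doubleSwap G i (move j _ f₁ f₂) with orient f₁ (lookup G i) | orient f₂ (lookup G j)
... | (v₁ , v₂) | (v₃ , v₄) = (v₂ , v₃) ∷ (v₄ , v₁) ∷ others G i j

-- Positions from which the Angel has a winning strategy (inductively: every
-- play following the strategy reaches a simple graph after finitely many moves).
data AngelWins {n} : Graph n → Set where
  won  : ∀ {G} → IsSimple G → AngelWins G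
  step : ∀ {G} →
         (∀ (i : EdgeIx G) → MultipleAt G i →
            Σ (AngelMove G i) λ m → AngelWins (doubleSwap G i m)) →
         AngelWins G

-- Fix a loop-free graph T with all multiplicities at most one and the same degree as G at every
-- vertex; a simple graph realising the degree sequence of G becomes one after relabelling its
-- vertices. Measure a position G by the potential Σ_{a,b} (mult T (a,b) ∸ mult G (a,b)), its
-- total deficit against T. When the Devil picks a multiple edge pq, in one of its two orientations
-- there are vertices x, z with qx missing from G, xz a surplus edge and z ≠ p; otherwise, since
-- surplus and deficit agree at every vertex (the degrees agree), counting gives both
-- deficit q < deficit p and deficit p < deficit q. The swap (p,q)(x,z) then removes two surplus
-- edges and adds the missing edge qx, so the potential strictly drops and every play ends.
module Submission where

open import Defs
open import Data.Bool using (Bool; true; false; if_then_else_)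
open import Data.Empty using (⊥-elim)
open import Data.Fin using (Fin; zero; suc; _≟_; cast)
open import Data.Fin.Permutation using (Permutation; _⟨$⟩ʳ_; _⟨$⟩ˡ_; _∘ₚ_; cast-id; inverseˡ; inverseʳ)
open import Data.Fin.Properties using (any?; cast-involutive)
import Data.Fin.Properties as Fin
open import Data.List using (List; []; _∷_; map; filter; lookup; allFin; length; tabulate)
open import Data.List.Membership.Propositional.Properties using (∈-lookup)
open import Data.List.Properties using (tabulate-lookup; map-∘; map-cong; map-tabulate; length-tabulate; lookup-tabulate)
open import Data.List.Relation.Binary.Permutation.Homogeneous using (onIndices)
open import Data.List.Relation.Binary.Permutation.Propositional using (_↭_; ↭⇒↭ₛ)
open import Data.List.Relation.Binary.Permutation.Setoid.Properties using (onIndices-lookup)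
open import Data.List.Relation.Unary.All using ([]; _∷_)
import Data.List.Relation.Unary.All as All
open import Data.List.Relation.Unary.All.Properties using (map⁺)
open import Data.Nat using (ℕ; zero; suc; _+_; _∸_; _≤_; _<_; z≤n; s≤s; _<?_)
open import Data.Nat.Induction using (<-wellFounded)
open import Data.Nat.ListAction using (sum)
open import Data.Nat.Properties hiding (_≟_)
open import Data.Nat.Tactic.RingSolver using (solve-∀)
open import Data.Product using (Σ; ∃-syntax; _×_; _,_; proj₁; proj₂)
open import Data.Sum using (_⊎_; inj₁; inj₂; [_,_]′)
open import Data.Vec.Functional using (Vector)
open import Function using (_∘_)
open import Function.Definitions using (Injective)
open import Induction.WellFounded using (Acc; acc)
open import Relation.Binary.PropositionalEquality
open import Relation.Nullary using (¬_; Dec; yes; no; does)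
open import Relation.Nullary.Decidable using (¬?; _×-dec_; _⊎-dec_)

open import Algebra.Properties.CommutativeMonoid.Sum +-0-commutativeMonoid
  using (∑-distrib-+; sum-cong-≗) renaming (sum to ∑)

private variable
  n : ℕ

-- Finite sums

∸-+-comm : ∀ a b → a ∸ b + b ≡ b ∸ a + a
∸-+-comm zero    zero    = refl
∸-+-comm zero    (suc b) = sym (+-identityʳ (suc b))
∸-+-comm (suc a) zero    = +-identityʳ (suc a)
∸-+-comm (suc a) (suc b) = trans (+-suc (a ∸ b) b) (trans (cong suc (∸-+-comm a b)) (sym (+-suc (b ∸ a) a)))

∑-mono-≤ : {f g : Vector ℕ n} → (∀ k → f k ≤ g k) → ∑ f ≤ ∑ g
∑-mono-≤ {zero}  f≤g = z≤n
∑-mono-≤ {suc n} f≤g = +-mono-≤ (f≤g zero) (∑-mono-≤ (f≤g ∘ suc))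

f≤∑f : (f : Vector ℕ n) (i : Fin n) → f i ≤ ∑ f
f≤∑f f zero    = m≤m+n _ _
f≤∑f f (suc i) = ≤-trans (f≤∑f (f ∘ suc) i) (m≤n+m _ _)

f+f≤∑f : (f : Vector ℕ n) {i j : Fin n} → i ≢ j → f i + f j ≤ ∑ f
f+f≤∑f f {zero}  {zero}  i≢j = ⊥-elim (i≢j refl)
f+f≤∑f f {zero}  {suc j} _   = +-monoʳ-≤ (f zero) (f≤∑f (f ∘ suc) j)
f+f≤∑f f {suc i} {zero}  _   = subst (_≤ ∑ f) (+-comm (f zero) (f (suc i))) (+-monoʳ-≤ (f zero) (f≤∑f (f ∘ suc) i))
f+f≤∑f f {suc i} {suc j} i≢j = ≤-trans (f+f≤∑f (f ∘ suc) (i≢j ∘ cong suc)) (m≤n+m _ _)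

∑-zero : (f : Vector ℕ n) → (∀ k → f k ≡ 0) → ∑ f ≡ 0
∑-zero {zero}  f f≡0 = refl
∑-zero {suc n} f f≡0 = cong₂ _+_ (f≡0 zero) (∑-zero (f ∘ suc) (f≡0 ∘ suc))

∑-supported : (f : Vector ℕ n) (i : Fin n) → (∀ k → k ≢ i → f k ≡ 0) → ∑ f ≡ f i
∑-supported f zero    f≡0 = trans (cong (f zero +_) (∑-zero (f ∘ suc) λ k → f≡0 (suc k) λ ())) (+-identityʳ _)
∑-supported f (suc i) f≡0 = cong₂ _+_ (f≡0 zero λ ()) (∑-supported (f ∘ suc) i λ k k≢i → f≡0 (suc k) (k≢i ∘ Fin.suc-injective))

∑-positive : (f : Vector ℕ n) → 0 < ∑ f → ∃[ k ] 0 < f k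
∑-positive {suc n} f 0<∑ with f zero in eq
... | suc _ = zero , subst (0 <_) (sym eq) (s≤s z≤n)
... | zero  = let k , 0<f = ∑-positive (f ∘ suc) 0<∑ in suc k , 0<f

∑-pick : (f : Vector ℕ n) (i : Fin n) → ∑ (λ k → if does (k ≟ i) then f k else 0) ≡ f i
∑-pick f i = trans (∑-supported _ i off) (on i)
  where
  off : ∀ k → k ≢ i → (if does (k ≟ i) then f k else 0) ≡ 0
  off k k≢i with k ≟ i
  ... | yes k≡i = ⊥-elim (k≢i k≡i)
  ... | no  _   = refl
  on : ∀ k → (if does (k ≟ k) then f k else 0) ≡ f k
  on k with k ≟ k
  ... | yes _   = refl
  ... | no  k≢k = ⊥-elim (k≢k refl)

∑-split-two : (f : Vector ℕ n) {i j : Fin n} → i ≢ j →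
              ∑ f ≡ f i + f j + ∑ (λ k → if does (¬? (k ≟ i) ×-dec ¬? (k ≟ j)) then f k else 0)
∑-split-two f {i} {j} i≢j = begin
  ∑ f                       ≡⟨ sum-cong-≗ split ⟩
  ∑ (λ k → pick i k + pick j k + rest k)    ≡⟨ ∑-distrib-+ (λ k → pick i k + pick j k) rest ⟩
  ∑ (λ k → pick i k + pick j k) + ∑ rest    ≡⟨ cong (_+ ∑ rest) (∑-distrib-+ (pick i) (pick j)) ⟩
  ∑ (pick i) + ∑ (pick j) + ∑ rest          ≡⟨ cong₂ (λ a b → a + b + ∑ rest) (∑-pick f i) (∑-pick f j) ⟩
  f i + f j + ∑ rest        ∎
  where
  open ≡-Reasoning
  pick : Fin _ → Fin _ → ℕ
  pick a k = if does (k ≟ a) then f k else 0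
  rest : Fin _ → ℕ
  rest k = if does (¬? (k ≟ i) ×-dec ¬? (k ≟ j)) then f k else 0
  split : ∀ k → f k ≡ pick i k + pick j k + rest k
  split k with k ≟ i | k ≟ j
  ... | yes refl | yes refl = ⊥-elim (i≢j refl)
  ... | yes _    | no  _    = sym (trans (+-identityʳ _) (+-identityʳ _))
  ... | no  _    | yes _    = sym (+-identityʳ _)
  ... | no  _    | no  _    = refl

∑≤1 : (f : Vector ℕ n) → (∀ k → f k ≤ 1) → (∀ k k′ → 0 < f k → 0 < f k′ → k ≡ k′) → ∑ f ≤ 1
∑≤1 f f≤1 unique with 0 <? ∑ f
... | no 0≮∑  = ≤-trans (≮⇒≥ 0≮∑) z≤n
... | yes 0<∑ with i , 0<fi ← ∑-positive f 0<∑ = subst (_≤ 1) (sym (∑-supported f i elsewhere)) (f≤1 i)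
  where
  elsewhere : ∀ k → k ≢ i → f k ≡ 0
  elsewhere k k≢i with 0 <? f k
  ... | yes 0<fk = ⊥-elim (k≢i (unique k i 0<fk 0<fi))
  ... | no  0≮fk = n≤0⇒n≡0 (≮⇒≥ 0≮fk)

sum-map-tabulate : ∀ {A : Set} (h : A → ℕ) (g : Fin n → A) → sum (map h (tabulate g)) ≡ ∑ (h ∘ g)
sum-map-tabulate {zero}  h g = refl
sum-map-tabulate {suc n} h g = cong (h (g zero) +_) (sum-map-tabulate h (g ∘ suc))

sum-map-lookup : ∀ {A : Set} (h : A → ℕ) (xs : List A) → sum (map h xs) ≡ ∑ (h ∘ lookup xs)
sum-map-lookup h xs = trans (cong (sum ∘ map h) (sym (tabulate-lookup xs))) (sum-map-tabulate h (lookup xs))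

sum-map-filter : ∀ {A : Set} {P : A → Set} (P? : ∀ x → Dec (P x)) (h : A → ℕ) (xs : List A) →
                 sum (map h (filter P? xs)) ≡ sum (map (λ x → if does (P? x) then h x else 0) xs)
sum-map-filter P? h []       = refl
sum-map-filter P? h (x ∷ xs) with does (P? x)
... | true  = cong (h x +_) (sum-map-filter P? h xs)
... | false = sum-map-filter P? h xs

sum-others : (f : Edge n → ℕ) (G : Graph n) {i j : EdgeIx G} → i ≢ j →
             sum (map f G) ≡ f (lookup G i) + f (lookup G j) + sum (map f (others G i j))
sum-others f G {i} {j} i≢j = begin
  sum (map f G)                                           ≡⟨ sum-map-lookup f G ⟩
  ∑ (f ∘ lookup G)                                        ≡⟨ ∑-split-two (f ∘ lookup G) i≢j ⟩
  f (lookup G i) + f (lookup G j) + ∑ rest                ≡⟨ cong (f (lookup G i) + f (lookup G j) +_) rest≡others ⟩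
  f (lookup G i) + f (lookup G j) + sum (map f (others G i j))  ∎
  where
  open ≡-Reasoning
  P? = λ k → ¬? (k ≟ i) ×-dec ¬? (k ≟ j)
  rest : EdgeIx G → ℕ
  rest k = if does (P? k) then f (lookup G k) else 0
  rest≡others : ∑ rest ≡ sum (map f (others G i j))
  rest≡others = begin
    ∑ rest                                                ≡⟨ sum-map-tabulate rest (λ k → k) ⟨
    sum (map rest (allFin (length G)))                    ≡⟨ sum-map-filter P? (f ∘ lookup G) (allFin _) ⟨
    sum (map (f ∘ lookup G) (filter P? (allFin _)))       ≡⟨ cong sum (map-∘ (filter P? (allFin _))) ⟩
    sum (map f (others G i j))                            ∎

-- Edge types and multiplicities

⟦_⟧ : ∀ {p} {P : Set p} → Dec P → ℕ
⟦ P? ⟧ = ind (does P?)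

module _ {p} {P : Set p} where

  ⟦⟧-yes : (P? : Dec P) → P → ⟦ P? ⟧ ≡ 1
  ⟦⟧-yes (yes _) _  = refl
  ⟦⟧-yes (no ¬p) p = ⊥-elim (¬p p)

  ⟦⟧-no : (P? : Dec P) → ¬ P → ⟦ P? ⟧ ≡ 0
  ⟦⟧-no (yes p) ¬p = ⊥-elim (¬p p)
  ⟦⟧-no (no _)  _  = refl

  ⟦⟧≤1 : (P? : Dec P) → ⟦ P? ⟧ ≤ 1
  ⟦⟧≤1 (yes _) = s≤s z≤n
  ⟦⟧≤1 (no _)  = z≤n

  ⟦⟧-positive : (P? : Dec P) → 0 < ⟦ P? ⟧ → P
  ⟦⟧-positive (yes p) _ = p

  ⟦⟧-⇔ : ∀ {q} {Q : Set q} (P? : Dec P) (Q? : Dec Q) → (P → Q) → (Q → P) → ⟦ P? ⟧ ≡ ⟦ Q? ⟧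
  ⟦⟧-⇔ (yes _) (yes _) _   _   = refl
  ⟦⟧-⇔ (yes p) (no ¬q) p→q _   = ⊥-elim (¬q (p→q p))
  ⟦⟧-⇔ (no ¬p) (yes q) _   q→p = ⊥-elim (¬p (q→p q))
  ⟦⟧-⇔ (no _)  (no _)  _   _   = refl

sameType? : (e e′ : Edge n) → Dec (SameType e e′)
sameType? (u , v) (x , y) = (u ≟ x ×-dec v ≟ y) ⊎-dec (u ≟ y ×-dec v ≟ x)

SameType-refl : (e : Edge n) → SameType e e
SameType-refl _ = inj₁ (refl , refl)

SameType-sym : {e e′ : Edge n} → SameType e e′ → SameType e′ e
SameType-sym (inj₁ (refl , refl)) = inj₁ (refl , refl)
SameType-sym (inj₂ (refl , refl)) = inj₂ (refl , refl)

SameType-trans : {e e′ e″ : Edge n} → SameType e e′ → SameType e′ e″ → SameType e e″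
SameType-trans (inj₁ (refl , refl)) s = s
SameType-trans (inj₂ (refl , refl)) (inj₁ (refl , refl)) = inj₂ (refl , refl)
SameType-trans (inj₂ (refl , refl)) (inj₂ (refl , refl)) = inj₁ (refl , refl)

SameType-flip : (a b : Fin n) → SameType (a , b) (b , a)
SameType-flip _ _ = inj₂ (refl , refl)

orient-SameType : (b : Bool) (e : Edge n) → SameType (orient b e) e
orient-SameType false _ = inj₁ (refl , refl)
orient-SameType true  _ = inj₂ (refl , refl)

SameType⇒orient : {e e′ : Edge n} → SameType e e′ → ∃[ b ] orient b e ≡ e′
SameType⇒orient (inj₁ (refl , refl)) = false , refl
SameType⇒orient (inj₂ (refl , refl)) = true , refl

infix 4 _∈ₑ_

_∈ₑ_ : Fin n → Edge n → Set
u ∈ₑ (a , b) = u ≡ a ⊎ u ≡ b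

∈ₑ-resp-SameType : {u : Fin n} {e e′ : Edge n} → SameType e e′ → u ∈ₑ e → u ∈ₑ e′
∈ₑ-resp-SameType (inj₁ (refl , refl)) u∈e        = u∈e
∈ₑ-resp-SameType (inj₂ (refl , refl)) (inj₁ u≡a) = inj₂ u≡a
∈ₑ-resp-SameType (inj₂ (refl , refl)) (inj₂ u≡b) = inj₁ u≡b

¬SameType-fst : {a b : Fin n} {e : Edge n} → ¬ a ∈ₑ e → ¬ SameType (a , b) e
¬SameType-fst a∉e s = a∉e (∈ₑ-resp-SameType s (inj₁ refl))

¬SameType-snd : {a b : Fin n} {e : Edge n} → ¬ b ∈ₑ e → ¬ SameType (a , b) e
¬SameType-snd b∉e s = b∉e (∈ₑ-resp-SameType s (inj₂ refl))

Incident⇒shared : (e e′ : Edge n) → Incident e e′ → ∃[ u ] u ∈ₑ e × u ∈ₑ e′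
Incident⇒shared (a , b) _ (inj₁ a∈e′) = a , inj₁ refl , a∈e′
Incident⇒shared (a , b) _ (inj₂ b∈e′) = b , inj₂ refl , b∈e′

shared⇒Incident : {u : Fin n} {e e′ : Edge n} → u ∈ₑ e → u ∈ₑ e′ → Incident e e′
shared⇒Incident (inj₁ refl) u∈e′ = inj₁ u∈e′
shared⇒Incident (inj₂ refl) u∈e′ = inj₂ u∈e′

Incident-resp-SameType : {e e′ f f′ : Edge n} → SameType e f → SameType e′ f′ → Incident e e′ → Incident f f′
Incident-resp-SameType {e = e} {e′} s s′ inc =
  let u , u∈e , u∈e′ = Incident⇒shared e e′ inc
  in  shared⇒Incident (∈ₑ-resp-SameType s u∈e) (∈ₑ-resp-SameType s′ u∈e′)

¬SameType-respʳ : {e e′ f : Edge n} → SameType e f → ¬ SameType e′ e → ¬ SameType e′ f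
¬SameType-respʳ s ¬s′ s′ = ¬s′ (SameType-trans s′ (SameType-sym s))

endsAt : Fin n → Edge n → ℕ
endsAt w e = ⟦ w ≟ proj₁ e ⟧ + ⟦ w ≟ proj₂ e ⟧

endsAt-resp-SameType : (w : Fin n) {e e′ : Edge n} → SameType e e′ → endsAt w e ≡ endsAt w e′
endsAt-resp-SameType w (inj₁ (refl , refl)) = refl
endsAt-resp-SameType w {e} (inj₂ (refl , refl)) = +-comm ⟦ w ≟ proj₁ e ⟧ ⟦ w ≟ proj₂ e ⟧

ofType : Edge n → Edge n → ℕ
ofType e f = ⟦ sameType? e f ⟧

ofType-≡1 : {e f : Edge n} → SameType e f → ofType e f ≡ 1
ofType-≡1 {e = e} {f} = ⟦⟧-yes (sameType? e f)

ofType-≡0 : {e f : Edge n} → ¬ SameType e f → ofType e f ≡ 0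
ofType-≡0 {e = e} {f} = ⟦⟧-no (sameType? e f)

ofType-resp-SameTypeˡ : {e e′ : Edge n} (f : Edge n) → SameType e e′ → ofType e f ≡ ofType e′ f
ofType-resp-SameTypeˡ {e = e} {e′} f s =
  ⟦⟧-⇔ (sameType? e f) (sameType? e′ f) (SameType-trans (SameType-sym s)) (SameType-trans s)

ofType-resp-SameTypeʳ : (e : Edge n) {f f′ : Edge n} → SameType f f′ → ofType e f ≡ ofType e f′
ofType-resp-SameTypeʳ e {f} {f′} s =
  ⟦⟧-⇔ (sameType? e f) (sameType? e f′) (λ t → SameType-trans t s) (λ t → SameType-trans t (SameType-sym s))

mult : Graph n → Edge n → ℕ
mult K f = sum (map (λ e → ofType e f) K)

mult-resp-SameType : (K : Graph n) {f f′ : Edge n} → SameType f f′ → mult K f ≡ mult K f′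
mult-resp-SameType K s = cong sum (map-cong (λ e → ofType-resp-SameTypeʳ e s) K)

mult-sym : (K : Graph n) (a b : Fin n) → mult K (a , b) ≡ mult K (b , a)
mult-sym K a b = mult-resp-SameType K (SameType-flip a b)

mult-loop : {K : Graph n} → LoopFree K → (a : Fin n) → mult K (a , a) ≡ 0
mult-loop {K = []}    []        a = refl
mult-loop {K = e ∷ K} (e≢ ∷ lf) a = cong₂ _+_ (ofType-≡0 loop) (mult-loop lf a)
  where
  loop : ¬ SameType e (a , a)
  loop (inj₁ (refl , refl)) = e≢ refl
  loop (inj₂ (refl , refl)) = e≢ refl

∑-ofType-from : {w q : Fin n} → w ≢ q → ∑ (λ b → ofType (w , q) (w , b)) ≡ 1
∑-ofType-from {w = w} {q} w≢q =
  trans (sum-cong-≗ λ b → ⟦⟧-⇔ (sameType? (w , q) (w , b)) (b ≟ q) to from) (∑-pick (λ _ → 1) q)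
  where
  to : ∀ {b} → SameType (w , q) (w , b) → b ≡ q
  to (inj₁ (_ , q≡b)) = sym q≡b
  to (inj₂ (_ , q≡w)) = ⊥-elim (w≢q (sym q≡w))
  from : ∀ {b} → b ≡ q → SameType (w , q) (w , b)
  from refl = inj₁ (refl , refl)

∑-ofType-row : {e : Edge n} → proj₁ e ≢ proj₂ e → (w : Fin n) → ∑ (λ b → ofType e (w , b)) ≡ endsAt w e
∑-ofType-row {e = p , q} p≢q w with w ≟ p | w ≟ q
... | yes refl | yes refl = ⊥-elim (p≢q refl)
... | yes refl | no w≢q   = ∑-ofType-from w≢q
... | no w≢p   | yes refl = trans (sum-cong-≗ λ b → ofType-resp-SameTypeˡ (w , b) (SameType-flip p w)) (∑-ofType-from w≢p)
... | no w≢p   | no w≢q   = ∑-zero _ λ b → ofType-≡0 {e = p , q} {w , b} λ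
  { (inj₁ (p≡w , _)) → w≢p (sym p≡w)
  ; (inj₂ (_ , q≡w)) → w≢q (sym q≡w) }

deg≡∑mult : {K : Graph n} → LoopFree K → (w : Fin n) → deg K w ≡ ∑ (λ b → mult K (w , b))
deg≡∑mult {K = []}    []        w = sym (∑-zero (λ b → mult [] (w , b)) λ _ → refl)
deg≡∑mult {K = e ∷ K} (e≢ ∷ lf) w = begin
  endsAt w e + deg K w                                        ≡⟨ cong₂ _+_ (sym (∑-ofType-row e≢ w)) (deg≡∑mult lf w) ⟩
  ∑ (λ b → ofType e (w , b)) + ∑ (λ b → mult K (w , b))       ≡⟨ ∑-distrib-+ (λ b → ofType e (w , b)) (λ b → mult K (w , b)) ⟨
  ∑ (λ b → ofType e (w , b) + mult K (w , b))                 ∎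
  where open ≡-Reasoning

IsSimple⇒mult≤1 : (K : Graph n) → IsSimple K → (f : Edge n) → mult K f ≤ 1
IsSimple⇒mult≤1 K simple f =
  subst (_≤ 1) (sym (sum-map-lookup (λ e → ofType e f) K))
    (∑≤1 _ (λ k → ⟦⟧≤1 (sameType? (lookup K k) f)) λ k k′ 0<k 0<k′ →
      simple k k′ (SameType-trans (⟦⟧-positive (sameType? (lookup K k) f) 0<k)
                                  (SameType-sym (⟦⟧-positive (sameType? (lookup K k′) f) 0<k′))))

MultipleAt⇒2≤mult : (G : Graph n) (i : EdgeIx G) → MultipleAt G i → 2 ≤ mult G (lookup G i)
MultipleAt⇒2≤mult G i (j , j≢i , s) = begin
  2                                                 ≡⟨ cong₂ _+_ (ofType-≡1 (SameType-refl e)) (ofType-≡1 (SameType-sym s)) ⟨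
  ofType e e + ofType (lookup G j) e                ≤⟨ f+f≤∑f (λ k → ofType (lookup G k) e) (j≢i ∘ sym) ⟩
  ∑ (λ k → ofType (lookup G k) e)                   ≡⟨ sum-map-lookup (λ e′ → ofType e′ e) G ⟨
  mult G e                                          ∎
  where
  open ≤-Reasoning
  e = lookup G i

mult-positive⇒edge : (K : Graph n) (f : Edge n) → 0 < mult K f → ∃[ k ] SameType (lookup K k) f
mult-positive⇒edge K f 0<mult =
  let k , 0<ofType = ∑-positive _ (subst (0 <_) (sum-map-lookup (λ e → ofType e f) K) 0<mult)
  in  k , ⟦⟧-positive (sameType? (lookup K k) f) 0<ofType

-- Realising a graphical degree sequence

tabulate-↭⇒permutation : ∀ {A : Set} (f g : Fin n → A) → tabulate f ↭ tabulate g →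
                         Σ (Permutation n n) λ π → ∀ i → f i ≡ g (π ⟨$⟩ʳ i)
tabulate-↭⇒permutation f g f↭g = π , λ i → begin
  f i                                              ≡⟨ lookup-tabulate f i ⟨
  lookup (tabulate f) (cast (sym |f|) i)           ≡⟨ onIndices-lookup (setoid _) (↭⇒↭ₛ f↭g) _ ⟩
  lookup (tabulate g) (σ ⟨$⟩ʳ cast (sym |f|) i)    ≡⟨ cong (lookup (tabulate g)) (cast-involutive (sym |g|) |g| _) ⟨
  lookup (tabulate g) (cast (sym |g|) (π ⟨$⟩ʳ i))  ≡⟨ lookup-tabulate g (π ⟨$⟩ʳ i) ⟩
  g (π ⟨$⟩ʳ i)                                     ∎
  where
  open ≡-Reasoning
  |f| = length-tabulate f
  |g| = length-tabulate g
  σ = onIndices (↭⇒↭ₛ f↭g)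
  π = cast-id (sym |f|) ∘ₚ σ ∘ₚ cast-id |g|

degList≡tabulate : (K : Graph n) → degList K ≡ tabulate (deg K)
degList≡tabulate K = map-tabulate (λ i → i) (deg K)

relabel : (Fin n → Fin n) → Graph n → Graph n
relabel σ = map λ e → σ (proj₁ e) , σ (proj₂ e)

module _ {σ : Fin n → Fin n} (σ-injective : Injective _≡_ _≡_ σ) where

  relabel-loopFree : {K : Graph n} → LoopFree K → LoopFree (relabel σ K)
  relabel-loopFree lf = map⁺ (All.map (λ a≢b σa≡σb → a≢b (σ-injective σa≡σb)) lf)

  relabel-deg : (K : Graph n) (w : Fin n) → deg (relabel σ K) (σ w) ≡ deg K w
  relabel-deg K w = cong sum (trans (sym (map-∘ K)) (map-cong endsAt-σ K))
    where
    endsAt-σ : ∀ e → endsAt (σ w) (σ (proj₁ e) , σ (proj₂ e)) ≡ endsAt w e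
    endsAt-σ (a , b) = cong₂ _+_ (⟦⟧-⇔ (σ w ≟ σ a) (w ≟ a) σ-injective (cong σ))
                                 (⟦⟧-⇔ (σ w ≟ σ b) (w ≟ b) σ-injective (cong σ))

  relabel-mult : (K : Graph n) (a b : Fin n) → mult (relabel σ K) (σ a , σ b) ≡ mult K (a , b)
  relabel-mult K a b = cong sum (trans (sym (map-∘ K)) (map-cong ofType-σ K))
    where
    ofType-σ : ∀ e → ofType (σ (proj₁ e) , σ (proj₂ e)) (σ a , σ b) ≡ ofType e (a , b)
    ofType-σ (x , y) = ⟦⟧-⇔ (sameType? _ _) (sameType? _ _) to from
      where
      to : SameType (σ x , σ y) (σ a , σ b) → SameType (x , y) (a , b)
      to (inj₁ (p , q)) = inj₁ (σ-injective p , σ-injective q)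
      to (inj₂ (p , q)) = inj₂ (σ-injective p , σ-injective q)
      from : SameType (x , y) (a , b) → SameType (σ x , σ y) (σ a , σ b)
      from (inj₁ (p , q)) = inj₁ (cong σ p , cong σ q)
      from (inj₂ (p , q)) = inj₂ (cong σ p , cong σ q)

record SimpleRealisation (G : Graph n) : Set where
  field
    graph    : Graph n
    loopFree : LoopFree graph
    mult≤1   : ∀ f → mult graph f ≤ 1
    deg≡     : ∀ w → deg graph w ≡ deg G w

Graphical⇒SimpleRealisation : (G : Graph n) → Graphical G → SimpleRealisation G
Graphical⇒SimpleRealisation G (H , H-loopFree , H-simple , H↭G) = record
  { graph    = relabel σ H
  ; loopFree = relabel-loopFree σ-injective H-loopFree
  ; mult≤1   = λ (a , b) → subst (_≤ 1) (mult-at-σ a b) (IsSimple⇒mult≤1 H H-simple (π ⟨$⟩ˡ a , π ⟨$⟩ˡ b))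
  ; deg≡     = λ w → begin
      deg (relabel σ H) w                   ≡⟨ cong (deg (relabel σ H)) (inverseʳ π) ⟨
      deg (relabel σ H) (σ (π ⟨$⟩ˡ w))      ≡⟨ relabel-deg σ-injective H (π ⟨$⟩ˡ w) ⟩
      deg H (π ⟨$⟩ˡ w)                      ≡⟨ deg-π (π ⟨$⟩ˡ w) ⟩
      deg G (σ (π ⟨$⟩ˡ w))                  ≡⟨ cong (deg G) (inverseʳ π) ⟩
      deg G w                               ∎
  }
  where
  open ≡-Reasoning
  matching = tabulate-↭⇒permutation (deg H) (deg G)
               (subst₂ _↭_ (degList≡tabulate H) (degList≡tabulate G) H↭G)
  π = proj₁ matching
  deg-π = proj₂ matching
  σ = π ⟨$⟩ʳ_
  σ-injective : Injective _≡_ _≡_ σ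
  σ-injective {a} {b} σa≡σb = trans (sym (inverseˡ π)) (trans (cong (π ⟨$⟩ˡ_) σa≡σb) (inverseˡ π))
  mult-at-σ : ∀ a b → mult H (π ⟨$⟩ˡ a , π ⟨$⟩ˡ b) ≡ mult (relabel σ H) (a , b)
  mult-at-σ a b = trans (sym (relabel-mult σ-injective H _ _))
                        (cong₂ (λ x y → mult (relabel σ H) (x , y)) (inverseʳ π) (inverseʳ π))

-- Double swaps

lookup-loopFree : {K : Graph n} → LoopFree K → (k : EdgeIx K) → proj₁ (lookup K k) ≢ proj₂ (lookup K k)
lookup-loopFree lf k = All.lookup lf (∈-lookup k)

orient-≢ : (b : Bool) {e : Edge n} → proj₁ e ≢ proj₂ e → proj₁ (orient b e) ≢ proj₂ (orient b e)
orient-≢ false a≢b = a≢b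
orient-≢ true  a≢b = a≢b ∘ sym

module Swap {G : Graph n} {i : EdgeIx G} (m : AngelMove G i) where

  open AngelMove m

  v₁ v₂ v₃ v₄ : Fin n
  v₁ = proj₁ (orient flipFirst (lookup G i))
  v₂ = proj₂ (orient flipFirst (lookup G i))
  v₃ = proj₁ (orient flipSecond (lookup G j))
  v₄ = proj₂ (orient flipSecond (lookup G j))

  e₁₂ e₃₄ e₂₃ e₄₁ : Edge n
  e₁₂ = v₁ , v₂
  e₃₄ = v₃ , v₄
  e₂₃ = v₂ , v₃
  e₄₁ = v₄ , v₁

open Swap using (v₁; v₂; v₃; v₄)

record Distinct₄ (a b c d : Fin n) : Set where
  field
    a≢b : a ≢ b
    a≢c : a ≢ c
    a≢d : a ≢ d
    b≢c : b ≢ c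
    b≢d : b ≢ d
    c≢d : c ≢ d

move-distinct : {G : Graph n} → LoopFree G → {i : EdgeIx G} (m : AngelMove G i) →
                Distinct₄ (v₁ m) (v₂ m) (v₃ m) (v₄ m)
move-distinct {G = G} lf {i} m@(move j ¬inc f₁ f₂) = record
  { a≢b = orient-≢ f₁ (lookup-loopFree lf i)
  ; a≢c = ¬inc ∘ incident ∘ inj₁ ∘ inj₁
  ; a≢d = ¬inc ∘ incident ∘ inj₁ ∘ inj₂
  ; b≢c = ¬inc ∘ incident ∘ inj₂ ∘ inj₁
  ; b≢d = ¬inc ∘ incident ∘ inj₂ ∘ inj₂
  ; c≢d = orient-≢ f₂ (lookup-loopFree lf j)
  }
  where
  incident : Incident (v₁ m , v₂ m) (v₃ m , v₄ m) → Incident (lookup G i) (lookup G j)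
  incident = Incident-resp-SameType (orient-SameType f₁ _) (orient-SameType f₂ _)

doubleSwap-≡ : (G : Graph n) (i : EdgeIx G) (m : AngelMove G i) →
               doubleSwap G i m ≡ (v₂ m , v₃ m) ∷ (v₄ m , v₁ m) ∷ others G i (AngelMove.j m)
doubleSwap-≡ G i (move j _ f₁ f₂) with orient f₁ (lookup G i) | orient f₂ (lookup G j)
... | _ , _ | _ , _ = refl

doubleSwap-loopFree : {G : Graph n} → LoopFree G → {i : EdgeIx G} (m : AngelMove G i) → LoopFree (doubleSwap G i m)
doubleSwap-loopFree {G = G} lf {i} m rewrite doubleSwap-≡ G i m =
  b≢c ∷ (a≢d ∘ sym) ∷ map⁺ (All.universal (lookup-loopFree lf) _)
  where open Distinct₄ (move-distinct lf m)

doubleSwap-sum : (f : Edge n → ℕ) → (∀ {e e′} → SameType e e′ → f e ≡ f e′) →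
                 (G : Graph n) (i : EdgeIx G) (m : AngelMove G i) →
                 sum (map f (doubleSwap G i m)) + f (v₁ m , v₂ m) + f (v₃ m , v₄ m)
                   ≡ f (v₂ m , v₃ m) + f (v₄ m , v₁ m) + sum (map f G)
doubleSwap-sum f f-resp G i m@(move j ¬inc f₁ f₂) rewrite doubleSwap-≡ G i m = begin
  f₂₃ + (f₄₁ + S) + f₁₂ + f₃₄      ≡⟨ regroup f₂₃ f₄₁ f₁₂ f₃₄ S ⟩
  f₂₃ + f₄₁ + (f₁₂ + f₃₄ + S)      ≡⟨ cong₂ (λ x y → f₂₃ + f₄₁ + (x + y + S))
                                             (f-resp (orient-SameType f₁ _)) (f-resp (orient-SameType f₂ _)) ⟩
  f₂₃ + f₄₁ + (f (lookup G i) + f (lookup G j) + S)  ≡⟨ cong (f₂₃ + f₄₁ +_) (sum-others f G i≢j) ⟨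
  f₂₃ + f₄₁ + sum (map f G)        ∎
  where
  open ≡-Reasoning
  f₁₂ = f (v₁ m , v₂ m)
  f₃₄ = f (v₃ m , v₄ m)
  f₂₃ = f (v₂ m , v₃ m)
  f₄₁ = f (v₄ m , v₁ m)
  S = sum (map f (others G i j))
  i≢j : i ≢ j
  i≢j refl = ¬inc (inj₁ (inj₁ refl))
  regroup : ∀ a b c d s → a + (b + s) + c + d ≡ a + b + (c + d + s)
  regroup = solve-∀

doubleSwap-deg : (G : Graph n) (i : EdgeIx G) (m : AngelMove G i) (w : Fin n) → deg (doubleSwap G i m) w ≡ deg G w
doubleSwap-deg G i m w = +-cancelʳ-≡ (endsAt w (v₁ m , v₂ m) + endsAt w (v₃ m , v₄ m)) _ _ (begin
  deg G′ w + (⟦ w ≟ v₁ m ⟧ + ⟦ w ≟ v₂ m ⟧ + (⟦ w ≟ v₃ m ⟧ + ⟦ w ≟ v₄ m ⟧))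
    ≡⟨ +-assoc (deg G′ w) _ _ ⟨
  deg G′ w + endsAt w (v₁ m , v₂ m) + endsAt w (v₃ m , v₄ m)
    ≡⟨ doubleSwap-sum (endsAt w) (endsAt-resp-SameType w) G i m ⟩
  ⟦ w ≟ v₂ m ⟧ + ⟦ w ≟ v₃ m ⟧ + (⟦ w ≟ v₄ m ⟧ + ⟦ w ≟ v₁ m ⟧) + deg G w
    ≡⟨ regroup ⟦ w ≟ v₁ m ⟧ ⟦ w ≟ v₂ m ⟧ ⟦ w ≟ v₃ m ⟧ ⟦ w ≟ v₄ m ⟧ (deg G w) ⟩
  deg G w + (⟦ w ≟ v₁ m ⟧ + ⟦ w ≟ v₂ m ⟧ + (⟦ w ≟ v₃ m ⟧ + ⟦ w ≟ v₄ m ⟧))  ∎)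
  where
  open ≡-Reasoning
  G′ = doubleSwap G i m
  regroup : ∀ a b c d s → b + c + (d + a) + s ≡ s + (a + b + (c + d))
  regroup = solve-∀

module SwapEffect {G : Graph n} (G-loopFree : LoopFree G) {i : EdgeIx G} (m : AngelMove G i) where

  open Distinct₄ (move-distinct G-loopFree m)
  open Swap m using (e₁₂; e₃₄; e₂₃; e₄₁)

  G′ : Graph n
  G′ = doubleSwap G i m

  e₁₂≁e₂₃ : ¬ SameType e₁₂ e₂₃
  e₁₂≁e₂₃ = ¬SameType-fst [ a≢b , a≢c ]′

  e₃₄≁e₂₃ : ¬ SameType e₃₄ e₂₃
  e₃₄≁e₂₃ = ¬SameType-snd [ b≢d ∘ sym , c≢d ∘ sym ]′

  e₄₁≁e₂₃ : ¬ SameType e₄₁ e₂₃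
  e₄₁≁e₂₃ = ¬SameType-fst [ b≢d ∘ sym , c≢d ∘ sym ]′

  e₃₄≁e₁₂ : ¬ SameType e₃₄ e₁₂
  e₃₄≁e₁₂ = ¬SameType-fst [ a≢c ∘ sym , b≢c ∘ sym ]′

  mult-balance : (f : Edge n) → mult G′ f + ofType e₁₂ f + ofType e₃₄ f ≡ ofType e₂₃ f + ofType e₄₁ f + mult G f
  mult-balance f = doubleSwap-sum (λ e → ofType e f) (ofType-resp-SameTypeˡ f) G i m

  mult-added : {f : Edge n} → SameType e₂₃ f → mult G′ f ≡ suc (mult G f)
  mult-added {f} s = begin
    mult G′ f                                      ≡⟨ +-identityʳ _ ⟨
    mult G′ f + 0                                  ≡⟨ +-identityʳ _ ⟨
    mult G′ f + 0 + 0                              ≡⟨ cong₂ (λ x y → mult G′ f + x + y) (ofType-≡0 (¬SameType-respʳ s e₁₂≁e₂₃))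
                                                                                          (ofType-≡0 (¬SameType-respʳ s e₃₄≁e₂₃)) ⟨
    mult G′ f + ofType e₁₂ f + ofType e₃₄ f        ≡⟨ mult-balance f ⟩
    ofType e₂₃ f + ofType e₄₁ f + mult G f         ≡⟨ cong₂ (λ x y → x + y + mult G f) (ofType-≡1 s) (ofType-≡0 (¬SameType-respʳ s e₄₁≁e₂₃)) ⟩
    suc (mult G f)                                 ∎
    where open ≡-Reasoning

  mult-removed : {f : Edge n} → SameType e₁₂ f ⊎ SameType e₃₄ f → mult G f ≤ suc (mult G′ f)
  mult-removed {f} s = begin
    mult G f                                       ≤⟨ m≤n+m _ _ ⟩
    ofType e₂₃ f + ofType e₄₁ f + mult G f         ≡⟨ mult-balance f ⟨
    mult G′ f + ofType e₁₂ f + ofType e₃₄ f        ≡⟨ +-assoc (mult G′ f) _ _ ⟩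
    mult G′ f + (ofType e₁₂ f + ofType e₃₄ f)      ≡⟨ cong (mult G′ f +_) (removed-once s) ⟩
    mult G′ f + 1                                  ≡⟨ +-comm _ 1 ⟩
    suc (mult G′ f)                                ∎
    where
    open ≤-Reasoning
    removed-once : SameType e₁₂ f ⊎ SameType e₃₄ f → ofType e₁₂ f + ofType e₃₄ f ≡ 1
    removed-once (inj₁ s₁₂) = cong₂ _+_ (ofType-≡1 s₁₂) (ofType-≡0 (¬SameType-respʳ s₁₂ e₃₄≁e₁₂))
    removed-once (inj₂ s₃₄) = cong₂ _+_ (ofType-≡0 (¬SameType-respʳ s₃₄ (e₃₄≁e₁₂ ∘ SameType-sym))) (ofType-≡1 s₃₄)

  mult-untouched : {f : Edge n} → ¬ SameType e₁₂ f → ¬ SameType e₃₄ f → mult G f ≤ mult G′ f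
  mult-untouched {f} ¬s₁₂ ¬s₃₄ = begin
    mult G f                                       ≤⟨ m≤n+m _ _ ⟩
    ofType e₂₃ f + ofType e₄₁ f + mult G f         ≡⟨ mult-balance f ⟨
    mult G′ f + ofType e₁₂ f + ofType e₃₄ f        ≡⟨ cong₂ (λ x y → mult G′ f + x + y) (ofType-≡0 ¬s₁₂) (ofType-≡0 ¬s₃₄) ⟩
    mult G′ f + 0 + 0                              ≡⟨ trans (+-identityʳ _) (+-identityʳ _) ⟩
    mult G′ f                                      ∎
    where open ≤-Reasoning

-- The Angel's strategy

module Strategy {T : Graph n} (T-loopFree : LoopFree T) (T-mult≤1 : ∀ f → mult T f ≤ 1) where

  surplus deficit : Graph n → Fin n → ℕ
  surplus G w = ∑ λ b → mult G (w , b) ∸ mult T (w , b)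
  deficit G w = ∑ λ b → mult T (w , b) ∸ mult G (w , b)

  potential : Graph n → ℕ
  potential G = ∑ (deficit G)

  module _ {G : Graph n} {i : EdgeIx G} (m : AngelMove G i) where

    open Swap m using (e₁₂; e₃₄; e₂₃; e₄₁)

    record Improving : Set where
      field
        surplus₁₂ : mult T e₁₂ < mult G e₁₂
        surplus₃₄ : mult T e₃₄ < mult G e₃₄
        missing₂₃ : mult G e₂₃ < mult T e₂₃

  module _ {G : Graph n} (G-loopFree : LoopFree G) {i : EdgeIx G} {m : AngelMove G i} (improving : Improving m) where

    open Swap m using (e₁₂; e₃₄; e₂₃; e₄₁)
    open SwapEffect G-loopFree m
    open Improving improving

    private
      transport : ∀ {e f} (K L : Graph n) → SameType e f → mult K e < mult L e → mult K f < mult L f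
      transport K L s = subst₂ _<_ (mult-resp-SameType K s) (mult-resp-SameType L s)

      deficit-removed : ∀ {f} → SameType e₁₂ f ⊎ SameType e₃₄ f → mult T f ∸ mult G′ f ≡ 0
      deficit-removed s = m≤n⇒m∸n≡0 (≤-pred (≤-trans (surplus-at s) (mult-removed s)))
        where
        surplus-at : ∀ {f} → SameType e₁₂ f ⊎ SameType e₃₄ f → mult T f < mult G f
        surplus-at = [ (λ s → transport T G s surplus₁₂) , (λ s → transport T G s surplus₃₄) ]′

    deficit-antitone : ∀ f → mult T f ∸ mult G′ f ≤ mult T f ∸ mult G f
    deficit-antitone f with sameType? e₁₂ f | sameType? e₃₄ f
    ... | yes s₁₂ | _       = ≤-trans (≤-reflexive (deficit-removed (inj₁ s₁₂))) z≤n
    ... | no _    | yes s₃₄ = ≤-trans (≤-reflexive (deficit-removed (inj₂ s₃₄))) z≤n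
    ... | no ¬s₁₂ | no ¬s₃₄ = ∸-monoʳ-≤ (mult T f) (mult-untouched ¬s₁₂ ¬s₃₄)

    deficit-drops : ∀ f → mult T f ∸ mult G′ f + ofType e₂₃ f ≤ mult T f ∸ mult G f
    deficit-drops f with sameType? e₂₃ f
    ... | no ¬s = begin
      mult T f ∸ mult G′ f + ofType e₂₃ f  ≡⟨ cong (mult T f ∸ mult G′ f +_) (ofType-≡0 ¬s) ⟩
      mult T f ∸ mult G′ f + 0             ≡⟨ +-identityʳ _ ⟩
      mult T f ∸ mult G′ f                 ≤⟨ deficit-antitone f ⟩
      mult T f ∸ mult G f                  ∎
      where open ≤-Reasoning
    ... | yes s = ≤-reflexive (begin
      mult T f ∸ mult G′ f + ofType e₂₃ f  ≡⟨ cong₂ (λ x y → mult T f ∸ x + y) (mult-added s) (ofType-≡1 s) ⟩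
      mult T f ∸ suc (mult G f) + 1        ≡⟨ +-comm _ 1 ⟩
      suc (mult T f ∸ suc (mult G f))      ≡⟨ +-∸-assoc 1 (transport G T s missing₂₃) ⟨
      mult T f ∸ mult G f                  ∎)
      where open ≡-Reasoning

    potential-decreases : potential G′ < potential G
    potential-decreases = begin-strict
      potential G′                                            <⟨ m<m+n (potential G′) added-somewhere ⟩
      potential G′ + ∑ (λ a → ∑ (added a))                    ≡⟨ ∑-distrib-+ (deficit G′) (∑ ∘ added) ⟨
      ∑ (λ a → deficit G′ a + ∑ (added a))                    ≡⟨ sum-cong-≗ (λ a → ∑-distrib-+ (deficit′ a) (added a)) ⟨
      ∑ (λ a → ∑ λ b → deficit′ a b + added a b)              ≤⟨ ∑-mono-≤ (λ a → ∑-mono-≤ λ b → deficit-drops (a , b)) ⟩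
      potential G                                             ∎
      where
      open ≤-Reasoning
      deficit′ added : Fin n → Fin n → ℕ
      deficit′ a b = mult T (a , b) ∸ mult G′ (a , b)
      added a b = ofType e₂₃ (a , b)
      added-somewhere : 0 < ∑ (λ a → ∑ (added a))
      added-somewhere = ≤-trans (≤-reflexive (sym (ofType-≡1 (SameType-refl e₂₃))))
                                (≤-trans (f≤∑f (added (v₂ m)) (v₃ m)) (f≤∑f (∑ ∘ added) (v₂ m)))

  module _ {G : Graph n} (G-loopFree : LoopFree G) (G-deg : ∀ w → deg G w ≡ deg T w) where

    surplus≡deficit : ∀ w → surplus G w ≡ deficit G w
    surplus≡deficit w = +-cancelʳ-≡ (∑ g) (surplus G w) (deficit G w) (begin
      surplus G w + ∑ g                     ≡⟨ cong (surplus G w +_) same-degree ⟨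
      surplus G w + ∑ h                     ≡⟨ ∑-distrib-+ (λ b → g b ∸ h b) h ⟨
      ∑ (λ b → g b ∸ h b + h b)             ≡⟨ sum-cong-≗ (λ b → ∸-+-comm (g b) (h b)) ⟩
      ∑ (λ b → h b ∸ g b + g b)             ≡⟨ ∑-distrib-+ (λ b → h b ∸ g b) g ⟩
      deficit G w + ∑ g                     ∎)
      where
      open ≡-Reasoning
      g h : Fin n → ℕ
      g b = mult G (w , b)
      h b = mult T (w , b)
      same-degree : ∑ h ≡ ∑ g
      same-degree = trans (sym (deg≡∑mult T-loopFree w)) (trans (sym (G-deg w)) (deg≡∑mult G-loopFree w))

    Continuation : Fin n → Fin n → Set
    Continuation p q = ∃[ x ] ∃[ z ] mult G (q , x) < mult T (q , x) × mult T (x , z) < mult G (x , z) × z ≢ p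

    continuation? : ∀ p q → Dec (Continuation p q)
    continuation? p q = any? λ x → any? λ z →
      mult G (q , x) <? mult T (q , x) ×-dec mult T (x , z) <? mult G (x , z) ×-dec ¬? (z ≟ p)

    surplus-towards : ∀ {p q x} → ¬ Continuation p q → mult G (q , x) < mult T (q , x) →
                      surplus G x ≡ mult G (x , p) ∸ mult T (x , p)
    surplus-towards {p} {q} {x} ¬cont missing = ∑-supported _ p no-surplus
      where
      no-surplus : ∀ z → z ≢ p → mult G (x , z) ∸ mult T (x , z) ≡ 0
      no-surplus z z≢p with mult T (x , z) <? mult G (x , z)
      ... | yes surplus-xz = ⊥-elim (¬cont (x , z , missing , surplus-xz , z≢p))
      ... | no  ¬surplus   = m≤n⇒m∸n≡0 (≮⇒≥ ¬surplus)

    -- Without a continuation, every b with qb missing carries all its surplus on bp, so the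
    -- deficit at q is dominated by the surplus at p, with one to spare at b = q.
    no-continuation : ∀ {p q} → 2 ≤ mult G (p , q) → ¬ Continuation p q → suc (deficit G q) ≤ surplus G p
    no-continuation {p} {q} 2≤pq ¬cont = begin
      suc (deficit G q)                                   ≡⟨ cong (_+ deficit G q) (∑-pick (λ _ → 1) q) ⟨
      ∑ (λ b → ⟦ b ≟ q ⟧) + deficit G q                   ≡⟨ ∑-distrib-+ (λ b → ⟦ b ≟ q ⟧) _ ⟨
      ∑ (λ b → ⟦ b ≟ q ⟧ + (mult T (q , b) ∸ mult G (q , b)))  ≤⟨ ∑-mono-≤ bound ⟩
      surplus G p                                         ∎
      where
      open ≤-Reasoning
      bound : ∀ b → ⟦ b ≟ q ⟧ + (mult T (q , b) ∸ mult G (q , b)) ≤ mult G (p , b) ∸ mult T (p , b)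
      bound b with b ≟ q
      ... | yes refl = begin
        suc (mult T (b , b) ∸ mult G (b , b))   ≡⟨ cong (λ t → suc (t ∸ mult G (b , b))) (mult-loop T-loopFree b) ⟩
        suc (0 ∸ mult G (b , b))                ≡⟨ cong suc (0∸n≡0 (mult G (b , b))) ⟩
        1                                       ≤⟨ m<n⇒0<n∸m (<-≤-trans (s≤s (T-mult≤1 (p , b))) 2≤pq) ⟩
        mult G (p , b) ∸ mult T (p , b)         ∎
      ... | no _ with mult G (q , b) <? mult T (q , b)
      ...   | no ¬missing = ≤-trans (≤-reflexive (m≤n⇒m∸n≡0 (≮⇒≥ ¬missing))) z≤n
      ...   | yes missing = begin
        mult T (q , b) ∸ mult G (q , b)   ≡⟨ cong₂ _∸_ (mult-sym T q b) (mult-sym G q b) ⟩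
        mult T (b , q) ∸ mult G (b , q)   ≤⟨ f≤∑f _ q ⟩
        deficit G b                       ≡⟨ surplus≡deficit b ⟨
        surplus G b                       ≡⟨ surplus-towards ¬cont missing ⟩
        mult G (b , p) ∸ mult T (b , p)   ≡⟨ cong₂ _∸_ (mult-sym G b p) (mult-sym T b p) ⟩
        mult G (p , b) ∸ mult T (p , b)   ∎

    continuation-exists : ∀ {p q} → 2 ≤ mult G (p , q) → Continuation p q ⊎ Continuation q p
    continuation-exists {p} {q} 2≤pq with continuation? p q | continuation? q p
    ... | yes cont | _        = inj₁ cont
    ... | no _     | yes cont = inj₂ cont
    ... | no ¬pq   | no ¬qp   = ⊥-elim (<-asym deficit-q<deficit-p deficit-p<deficit-q)
      where
      deficit-q<deficit-p : deficit G q < deficit G p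
      deficit-q<deficit-p = subst (deficit G q <_) (surplus≡deficit p) (no-continuation 2≤pq ¬pq)
      deficit-p<deficit-q : deficit G p < deficit G q
      deficit-p<deficit-q = subst (deficit G p <_) (surplus≡deficit q)
                              (no-continuation (subst (2 ≤_) (mult-sym G p q) 2≤pq) ¬qp)

    continuation-avoids : ∀ {p q x z} → 2 ≤ mult G (p , q) → mult G (q , x) < mult T (q , x) →
                          mult T (x , z) < mult G (x , z) → z ≢ p → ¬ Incident (p , q) (x , z)
    continuation-avoids {p} {q} {x} {z} 2≤pq missing-qx surplus-xz z≢p =
      [ [ x≢p ∘ sym , z≢p ∘ sym ]′ , [ x≢q ∘ sym , z≢q ∘ sym ]′ ]′
      where
      x≢p : x ≢ p
      x≢p refl = <⇒≱ (≤-trans missing-qx (T-mult≤1 (q , x))) (≤-trans (s≤s z≤n) (subst (2 ≤_) (mult-sym G x q) 2≤pq))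
      x≢q : x ≢ q
      x≢q refl = <-irrefl (trans (mult-loop G-loopFree x) (sym (mult-loop T-loopFree x))) missing-qx
      z≢q : z ≢ q
      z≢q refl = <-asym missing-qx (subst₂ _<_ (mult-sym T x q) (mult-sym G x q) surplus-xz)

    continuation⇒move : (i : EdgeIx G) (b : Bool) {p q : Fin n} → orient b (lookup G i) ≡ (p , q) →
                        2 ≤ mult G (p , q) → Continuation p q → Σ (AngelMove G i) Improving
    continuation⇒move i b {p} {q} pq-orient 2≤pq (x , z , missing-qx , surplus-xz , z≢p) =
      move k ¬incident b b′ , record
        { surplus₁₂ = subst (λ e → mult T e < mult G e) (sym pq-orient) (<-≤-trans (s≤s (T-mult≤1 (p , q))) 2≤pq)
        ; surplus₃₄ = subst (λ e → mult T e < mult G e) (sym xz-orient) surplus-xz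
        ; missing₂₃ = subst (λ e → mult G e < mult T e) (sym qx-orient) missing-qx
        }
      where
      k-xz : ∃[ k ] SameType (lookup G k) (x , z)
      k-xz = mult-positive⇒edge G (x , z) (≤-<-trans z≤n surplus-xz)
      k = proj₁ k-xz
      b′ = proj₁ (SameType⇒orient (proj₂ k-xz))
      xz-orient : orient b′ (lookup G k) ≡ (x , z)
      xz-orient = proj₂ (SameType⇒orient (proj₂ k-xz))
      qx-orient : (proj₂ (orient b (lookup G i)) , proj₁ (orient b′ (lookup G k))) ≡ (q , x)
      qx-orient = cong₂ _,_ (cong proj₂ pq-orient) (cong proj₁ xz-orient)
      ¬incident : ¬ Incident (lookup G i) (lookup G k)
      ¬incident = continuation-avoids 2≤pq missing-qx surplus-xz z≢p
                ∘ Incident-resp-SameType (subst (SameType _) pq-orient (SameType-sym (orient-SameType b _))) (proj₂ k-xz)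

    improving-move : (i : EdgeIx G) → MultipleAt G i → Σ (AngelMove G i) Improving
    improving-move i multiple with continuation-exists (MultipleAt⇒2≤mult G i multiple)
    ... | inj₁ cont = continuation⇒move i false refl (MultipleAt⇒2≤mult G i multiple) cont
    ... | inj₂ cont = continuation⇒move i true refl
                        (subst (2 ≤_) (mult-sym G _ _) (MultipleAt⇒2≤mult G i multiple)) cont

  angel-wins : (G : Graph n) → LoopFree G → (∀ w → deg G w ≡ deg T w) → AngelWins G
  angel-wins G lf same-deg = go G lf same-deg (<-wellFounded (potential G))
    where
    go : (G : Graph n) → LoopFree G → (∀ w → deg G w ≡ deg T w) → Acc _<_ (potential G) → AngelWins G
    go G lf same-deg (acc smaller) = step λ i multiple →
      let m , improving = improving-move lf same-deg i multiple
      in  m , go (doubleSwap G i m) (doubleSwap-loopFree lf m)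
                 (λ w → trans (doubleSwap-deg G i m w) (same-deg w))
                 (smaller (potential-decreases lf improving))

theorem3p4 : (n : ℕ) (G : Graph n) → LoopFree G → Graphical G → AngelWins G
theorem3p4 n G lf graphical = Strategy.angel-wins loopFree mult≤1 G lf (λ w → sym (deg≡ w))
  where open SimpleRealisation (Graphical⇒SimpleRealisation G graphical)
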